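{- Let $R_{n,k}$ be as defined in the context. For $n\ge1$ and $k\ge1$, \[R_{n,k}=(2k+1)R_{n-1,k}+(n-2k+1)R_{n-1,k-1},\] and moreover $R_{n,0}=1$ for all $n\ge0$ and $R_{0,k}=0$ for all $k\ge1$.
   Context: For $n\ge1$, $S_n$ is the set of permutations of $\{0,\dots,n-1\}$ in one-line notation. A 3-dimensional permutation of length $n$ is a pair $\Pi=(\pi^2,\pi^3)$ of elements of $S_n$ (for $n=0$, the single empty permutation); its elements are the columns $\Pi_j=(\pi^2_j,\pi^3_j)^T$, and the level of $\Pi_j$ is $\max\{\pi^2_j,\pi^3_j\}$. $\Pi$ is canonical if $\pi^2=01\cdots(n-1)$. Each level value is attained by at most two elements. $R_{n,k}$ is the number of canonical 3-dimensional permutations of length $n$ in which exactly $k$ distinct level values are each attained by two elements. -}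

module Defs where

open import Data.Nat using (ℕ; zero; suc; _⊔_; _≡ᵇ_)
open import Data.Bool using (Bool; true; false; if_then_else_; _∧_; not)
open import Data.List using (List; []; _∷_; map; concatMap; length; filter; upTo; zip)
open import Data.Bool.ListAction using (any)
open import Relation.Nullary.Decidable using (does)
open import Data.Nat.Properties using (_≟_)

words : ℕ → ℕ → List (List ℕ)
words n zero = [] ∷ []
words n (suc m) = concatMap (λ x → map (x ∷_) (words n m)) (upTo n)

elemᵇ : ℕ → List ℕ → Bool
elemᵇ x xs = any (x ≡ᵇ_) xs

distinctᵇ : List ℕ → Bool
distinctᵇ [] = true
distinctᵇ (x ∷ xs) = not (elemᵇ x xs) ∧ distinctᵇ xs

-- S_n : permutations of {0,…,n-1} in one-line notation
-- (words of length n over {0,…,n-1} with distinct entries)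
Sn : ℕ → List (List ℕ)
Sn n = filter (λ w → distinctᵇ w Data.Bool.≟ true) (words n n)

-- A canonical 3-dimensional permutation of length n is (id, π³) with π³ ∈ S_n;
-- the level of column j is max(j, π³_j).
levels : List ℕ → List ℕ
levels π = map (λ p → Data.Product.proj₁ p ⊔ Data.Product.proj₂ p) (zip (upTo (length π)) π)
  where import Data.Product

countEq : ℕ → List ℕ → ℕ
countEq v xs = length (filter (λ x → x ≟ v) xs)

doubleLevels : List ℕ → ℕ
doubleLevels π = length (filter (λ v → countEq v (levels π) ≟ 2) (upTo (length π)))

R : ℕ → ℕ → ℕ
R n k = length (filter (λ π → doubleLevels π ≟ k) (Sn n))

-- Every σ ∈ S_(m+1)
-- is obtained exactly once as extend m π i with π ∈ S_m and i ≤ m: the new maximum m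
-- is written at position i and the displaced entry π_i is appended.  On levels this
-- overwrites the level ℓ of column i by m and appends a second m.  Thus i = m keeps
-- the number d of doubled levels, and i < m gains the doubled level m but loses ℓ as
-- a doubled level exactly when ℓ was doubled (no level occurs three times, as at most
-- one column j has j = ℓ and at most one has π_j = ℓ).  A doubled level occupies two columns,
-- so 2d positions i < m give d doubled levels and the remaining m − 2d give d + 1.
-- Hence each π ∈ S_m with d doubled levels has 2d + 1 extensions with d and m − 2d
-- extensions with d + 1 doubled levels, which is the recurrence.

module Submission where

open import Defs

open import Relation.Binary.PropositionalEquality hiding ([_])
open import Data.Bool as Bool using (true; false)
open import Data.Bool.Properties using (T-≡; ¬-not)
open import Data.List
  using (List; []; _∷_; _++_; _∷ʳ_; [_]; map; filter; length; upTo; applyUpTo; zip;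
         cartesianProductWith; concatMap; initLast; _∷ʳ′_)
open import Data.List.Properties
  using (length-++; map-++; map-∘; map-cong-local; filter-++; filter-none; length-filter;
         upTo-∷ʳ; map-upTo; length-upTo; ∷-injective; ∷ʳ-injective; ++-assoc)
open import Data.List.Membership.Propositional using (_∈_; _∉_)
open import Data.List.Membership.Propositional.Properties
  using (∈-∃++; ∈-filter⁺; ∈-filter⁻; ∈-upTo⁺; ∈-upTo⁻; ∈-map⁻;
         ∈-cartesianProductWith⁺; ∈-cartesianProductWith⁻)
open import Data.List.Membership.Propositional.Properties.WithK using (unique∧set⇒bag)
open import Data.List.Relation.Binary.BagAndSetEquality using (∼bag⇒↭)
open import Data.List.Relation.Binary.Permutation.Propositional
  using (_↭_; ↭-refl; ↭-sym; ↭-trans; ↭-prep; ↭-swap; ↭⇒↭ₛ)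
open import Data.List.Relation.Binary.Permutation.Propositional.Properties
  using (All-resp-↭; ↭-length; filter-↭; ∷↭∷ʳ)
open import Data.List.Relation.Unary.All as All using (All; []; _∷_)
import Data.List.Relation.Unary.All.Properties as All
open import Data.List.Relation.Unary.Any as Any using (here; there)
open import Data.List.Relation.Unary.Any.Properties using (any⁺; any⁻)
open import Data.List.Relation.Unary.Unique.Propositional using (Unique; []; _∷_)
import Data.List.Relation.Unary.Unique.Propositional.Properties as Unique
open import Data.Nat
  using (ℕ; zero; suc; _+_; _*_; _∸_; _⊔_; _≤_; _<_; z≤n; s≤s; s≤s⁻¹; _≤?_)
open import Data.Nat.ListAction using (sum)
open import Data.Nat.ListAction.Properties using (sum-++)
open import Data.Nat.Properties
open import Data.List.Membership.DecPropositional _≟_ using (_∈?_)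
open import Data.List.Relation.Binary.Permutation.Setoid.Properties (setoid ℕ)
  using (Unique-resp-↭)
open import Algebra.Properties.CommutativeSemigroup +-commutativeSemigroup
  using (interchange; x∙yz≈y∙xz; xy∙z≈xz∙y)
open import Data.Product using (_×_; _,_; proj₁; proj₂; ∃₂)
open import Data.Sum using (_⊎_; inj₁; inj₂)
open import Function using (_∘_; _⇔_; mk⇔; Equivalence; case_of_)
open import Relation.Binary.Definitions using (tri<; tri≈; tri>)
open import Relation.Nullary using (Dec; yes; no; ¬_; ¬?; contradiction)
open import Relation.Unary using (Decidable)
import Data.Integer as ℤ
import Data.Integer.Properties as ℤ
open import Data.Integer.Solver using (module +-*-Solver)

-- Indicator functions and sums over lists

𝟙 : {P : Set} → Dec P → ℕ
𝟙 (yes _) = 1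
𝟙 (no _)  = 0

module _ {P : Set} where

  𝟙-yes : (p? : Dec P) → P → 𝟙 p? ≡ 1
  𝟙-yes (yes _) _ = refl
  𝟙-yes (no ¬p) p = contradiction p ¬p

  𝟙-no : (p? : Dec P) → ¬ P → 𝟙 p? ≡ 0
  𝟙-no (yes p) ¬p = contradiction p ¬p
  𝟙-no (no _)  _  = refl

  𝟙≤1 : (p? : Dec P) → 𝟙 p? ≤ 1
  𝟙≤1 (yes _) = ≤-refl
  𝟙≤1 (no _)  = z≤n

  𝟙-mono : {Q : Set} (p? : Dec P) (q? : Dec Q) → (P → Q) → 𝟙 p? ≤ 𝟙 q?
  𝟙-mono (yes p) (yes _) _   = ≤-refl
  𝟙-mono (yes p) (no ¬q) p⇒q = contradiction (p⇒q p) ¬q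
  𝟙-mono (no _)  _       _   = z≤n

∑ : {A : Set} → (A → ℕ) → List A → ℕ
∑ f xs = sum (map f xs)

module _ {A : Set} where

  ∑-++ : (f : A → ℕ) (xs ys : List A) → ∑ f (xs ++ ys) ≡ ∑ f xs + ∑ f ys
  ∑-++ f xs ys = trans (cong sum (map-++ f xs ys)) (sum-++ (map f xs) (map f ys))

  ∑-map : {B : Set} (f : B → ℕ) (g : A → B) (xs : List A) → ∑ f (map g xs) ≡ ∑ (f ∘ g) xs
  ∑-map f g xs = cong sum (sym (map-∘ xs))

  ∑-cong : {f g : A → ℕ} (xs : List A) → (∀ {x} → x ∈ xs → f x ≡ g x) → ∑ f xs ≡ ∑ g xs
  ∑-cong xs f≐g = cong sum (map-cong-local (All.tabulate f≐g))

  ∑-zero : (f : A → ℕ) (xs : List A) → (∀ {x} → x ∈ xs → f x ≡ 0) → ∑ f xs ≡ 0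
  ∑-zero f []       _   = refl
  ∑-zero f (x ∷ xs) f≡0 = cong₂ _+_ (f≡0 (here refl)) (∑-zero f xs (f≡0 ∘ there))

  ∑-+ : (f g : A → ℕ) (xs : List A) → ∑ (λ x → f x + g x) xs ≡ ∑ f xs + ∑ g xs
  ∑-+ f g []       = refl
  ∑-+ f g (x ∷ xs) =
    trans (cong (f x + g x +_) (∑-+ f g xs)) (interchange (f x) (g x) (∑ f xs) (∑ g xs))

  ∑-*ˡ : (c : ℕ) (f : A → ℕ) (xs : List A) → ∑ (λ x → c * f x) xs ≡ c * ∑ f xs
  ∑-*ˡ c f []       = sym (*-zeroʳ c)
  ∑-*ˡ c f (x ∷ xs) =
    trans (cong (c * f x +_) (∑-*ˡ c f xs)) (sym (*-distribˡ-+ c (f x) (∑ f xs)))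

module _ {A : Set} {P : A → Set} (P? : Decidable P) where

  length-filter≡∑𝟙 : (xs : List A) → length (filter P? xs) ≡ ∑ (𝟙 ∘ P?) xs
  length-filter≡∑𝟙 []       = refl
  length-filter≡∑𝟙 (x ∷ xs) with P? x
  ... | yes _ = cong suc (length-filter≡∑𝟙 xs)
  ... | no  _ = length-filter≡∑𝟙 xs

  length-filter+length-filter-¬ : (xs : List A) →
    length (filter P? xs) + length (filter (¬? ∘ P?) xs) ≡ length xs
  length-filter+length-filter-¬ []       = refl
  length-filter+length-filter-¬ (x ∷ xs) with P? x
  ... | yes _ = cong suc (length-filter+length-filter-¬ xs)
  ... | no  _ = trans (+-suc _ _) (cong suc (length-filter+length-filter-¬ xs))

  ∑-∘𝟙 : (g : ℕ → ℕ) (xs : List A) →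
    ∑ (g ∘ 𝟙 ∘ P?) xs ≡ length (filter P? xs) * g 1 + length (filter (¬? ∘ P?) xs) * g 0
  ∑-∘𝟙 g []       = refl
  ∑-∘𝟙 g (x ∷ xs) with P? x
  ... | yes _ = trans (cong (g 1 +_) (∑-∘𝟙 g xs)) (sym (+-assoc (g 1) _ _))
  ... | no  _ = trans (cong (g 0 +_) (∑-∘𝟙 g xs))
                      (x∙yz≈y∙xz (g 0) (length (filter P? xs) * g 1) (length (filter (¬? ∘ P?) xs) * g 0))

module _ {A : Set} where

  unique∧set⇒↭ : {xs ys : List A} → Unique xs → Unique ys → (∀ {z} → z ∈ xs ⇔ z ∈ ys) → xs ↭ ys
  unique∧set⇒↭ xs! ys! xs≈ys = ∼bag⇒↭ (unique∧set⇒bag xs! ys! xs≈ys)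

  map-unique : {B : Set} {f : A → B} {xs : List A} →
    (∀ {x y} → x ∈ xs → y ∈ xs → f x ≡ f y → x ≡ y) → Unique xs → Unique (map f xs)
  map-unique f-inj []          = []
  map-unique f-inj (x∉xs ∷ xs!) =
    All.map⁺ (All.tabulate (λ y∈xs fx≡fy → All.lookup x∉xs y∈xs (f-inj (here refl) (there y∈xs) fx≡fy)))
    ∷ map-unique (λ x∈ y∈ → f-inj (there x∈) (there y∈)) xs!

module _ {A B C : Set} (f : A → B → C) where

  cartesianProductWith-unique : {xs : List A} {ys : List B} → Unique xs → Unique ys →
    (∀ {a a′ b b′} → a ∈ xs → a′ ∈ xs → b ∈ ys → b′ ∈ ys → f a b ≡ f a′ b′ → a ≡ a′ × b ≡ b′) →
    Unique (cartesianProductWith f xs ys)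
  cartesianProductWith-unique []           ys! f-inj = []
  cartesianProductWith-unique {x ∷ xs} {ys} (x∉xs ∷ xs!) ys! f-inj =
    Unique.++⁺ (map-unique (λ b∈ b′∈ → proj₂ ∘ f-inj (here refl) (here refl) b∈ b′∈) ys!)
               (cartesianProductWith-unique xs! ys! (λ a∈ a′∈ → f-inj (there a∈) (there a′∈)))
               disjoint
    where
    disjoint : ∀ {v} → ¬ (v ∈ map (f x) ys × v ∈ cartesianProductWith f xs ys)
    disjoint (v∈row , v∈rest) with ∈-map⁻ (f x) v∈row | ∈-cartesianProductWith⁻ f xs ys v∈rest
    ... | b , b∈ys , refl | a , b′ , a∈xs , b′∈ys , fxb≡fab′ =
      All.lookup x∉xs a∈xs (proj₁ (f-inj (here refl) (there a∈xs) b∈ys b′∈ys fxb≡fab′))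

  length-filter-cartesianProductWith : {P : C → Set} (P? : Decidable P) (xs : List A) (ys : List B) →
    length (filter P? (cartesianProductWith f xs ys)) ≡ ∑ (λ x → length (filter P? (map (f x) ys))) xs
  length-filter-cartesianProductWith P? []       ys = refl
  length-filter-cartesianProductWith P? (x ∷ xs) ys = begin
    length (filter P? (map (f x) ys ++ cartesianProductWith f xs ys))
      ≡⟨ cong length (filter-++ P? (map (f x) ys) _) ⟩
    length (filter P? (map (f x) ys) ++ filter P? (cartesianProductWith f xs ys))
      ≡⟨ length-++ (filter P? (map (f x) ys)) ⟩
    length (filter P? (map (f x) ys)) + length (filter P? (cartesianProductWith f xs ys))
      ≡⟨ cong (length (filter P? (map (f x) ys)) +_) (length-filter-cartesianProductWith P? xs ys) ⟩
    ∑ (λ x → length (filter P? (map (f x) ys))) (x ∷ xs) ∎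
    where open ≡-Reasoning

pigeonhole : ∀ {n} {xs : List ℕ} → Unique xs → All (_< n) xs → length xs ≤ n
pigeonhole {n} {xs} xs! xs<n = begin
  length xs                         ≡⟨ ↭-length xs↭ ⟩
  length (filter (_∈? xs) (upTo n)) ≤⟨ length-filter (_∈? xs) (upTo n) ⟩
  length (upTo n)                   ≡⟨ length-upTo n ⟩
  n                                 ∎
  where
  open ≤-Reasoning
  xs↭ : xs ↭ filter (_∈? xs) (upTo n)
  xs↭ = unique∧set⇒↭ xs! (Unique.filter⁺ (_∈? xs) (Unique.upTo⁺ n)) (mk⇔
    (λ z∈xs → ∈-filter⁺ (_∈? xs) (∈-upTo⁺ (All.lookup xs<n z∈xs)) z∈xs)
    (λ z∈ → proj₂ (∈-filter⁻ (_∈? xs) {xs = upTo n} z∈)))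

countEq-∷ : ∀ v y xs → countEq v (y ∷ xs) ≡ 𝟙 (y ≟ v) + countEq v xs
countEq-∷ v y xs =
  trans (length-filter≡∑𝟙 (_≟ v) (y ∷ xs)) (cong (𝟙 (y ≟ v) +_) (sym (length-filter≡∑𝟙 (_≟ v) xs)))

countEq-++ : ∀ v xs ys → countEq v (xs ++ ys) ≡ countEq v xs + countEq v ys
countEq-++ v xs ys = trans (cong length (filter-++ (_≟ v) xs ys)) (length-++ (filter (_≟ v) xs))

countEq-∷ʳ : ∀ v xs y → countEq v (xs ∷ʳ y) ≡ countEq v xs + 𝟙 (y ≟ v)
countEq-∷ʳ v xs y =
  trans (countEq-++ v xs [ y ]) (cong (countEq v xs +_) (trans (countEq-∷ v y []) (+-identityʳ _)))

countEq-↭ : ∀ v {xs ys} → xs ↭ ys → countEq v xs ≡ countEq v ys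
countEq-↭ v xs↭ys = ↭-length (filter-↭ (_≟ v) xs↭ys)

countEq-∉ : ∀ {v xs} → v ∉ xs → countEq v xs ≡ 0
countEq-∉ {v} {xs} v∉xs =
  cong length (filter-none (_≟ v) (All.tabulate (λ x∈xs x≡v → v∉xs (subst (_∈ xs) x≡v x∈xs))))

Unique⇒countEq≤1 : ∀ v {xs} → Unique xs → countEq v xs ≤ 1
Unique⇒countEq≤1 v []                          = z≤n
Unique⇒countEq≤1 v {y ∷ xs} (y∉xs ∷ xs!) rewrite countEq-∷ v y xs with y ≟ v
... | yes refl = s≤s (≤-reflexive (countEq-∉ (Unique.Unique[x∷xs]⇒x∉xs (y∉xs ∷ xs!))))
... | no  _    = Unique⇒countEq≤1 v xs!

∑-δ : (h : ℕ → ℕ) {y : ℕ} {vs : List ℕ} → Unique vs → y ∈ vs → ∑ (λ v → 𝟙 (y ≟ v) * h v) vs ≡ h y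
∑-δ h {y} (y∉vs ∷ vs!) (here refl) =
  trans (cong₂ _+_ (cong (_* h y) (𝟙-yes (y ≟ y) refl))
                   (∑-zero _ _ (λ v∈vs → cong (_* h _) (𝟙-no (y ≟ _) (All.lookup y∉vs v∈vs)))))
        (trans (+-identityʳ _) (*-identityˡ (h y)))
∑-δ h {y} (v∉vs ∷ vs!) (there y∈vs) =
  trans (cong (λ c → c * h _ + _) (𝟙-no (y ≟ _) (λ y≡v → All.lookup v∉vs y∈vs (sym y≡v))))
        (∑-δ h vs! y∈vs)

∑-update : {f g : ℕ → ℕ} {y : ℕ} {vs : List ℕ} → Unique vs → y ∈ vs →
  (∀ {v} → v ∈ vs → v ≢ y → f v ≡ g v) → ∑ f vs + g y ≡ ∑ g vs + f y
∑-update {f} {g} {y} {vs} vs! y∈vs f≐g = begin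
  ∑ f vs + g y                                 ≡⟨ cong (∑ f vs +_) (∑-δ g vs! y∈vs) ⟨
  ∑ f vs + ∑ (λ v → 𝟙 (y ≟ v) * g v) vs       ≡⟨ ∑-+ f _ vs ⟨
  ∑ (λ v → f v + 𝟙 (y ≟ v) * g v) vs          ≡⟨ ∑-cong vs exchange ⟩
  ∑ (λ v → g v + 𝟙 (y ≟ v) * f v) vs          ≡⟨ ∑-+ g _ vs ⟩
  ∑ g vs + ∑ (λ v → 𝟙 (y ≟ v) * f v) vs       ≡⟨ cong (∑ g vs +_) (∑-δ f vs! y∈vs) ⟩
  ∑ g vs + f y                                 ∎
  where
  open ≡-Reasoning
  exchange : ∀ {v} → v ∈ vs → f v + 𝟙 (y ≟ v) * g v ≡ g v + 𝟙 (y ≟ v) * f v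
  exchange {v} v∈vs with y ≟ v
  ... | yes refl = trans (cong (f y +_) (+-identityʳ (g y)))
                         (trans (+-comm (f y) (g y)) (cong (g y +_) (sym (+-identityʳ (f y)))))
  ... | no  y≢v  = cong (_+ 0) (f≐g v∈vs (y≢v ∘ sym))

∑-byValue : (h : ℕ → ℕ) {vs : List ℕ} → Unique vs → ∀ xs → All (_∈ vs) xs →
  ∑ h xs ≡ ∑ (λ v → countEq v xs * h v) vs
∑-byValue h {vs} vs! []       []             = sym (∑-zero _ vs (λ _ → refl))
∑-byValue h {vs} vs! (y ∷ xs) (y∈vs ∷ xs⊆vs) = begin
  h y + ∑ h xs
    ≡⟨ cong₂ _+_ (sym (∑-δ h vs! y∈vs)) (∑-byValue h vs! xs xs⊆vs) ⟩
  ∑ (λ v → 𝟙 (y ≟ v) * h v) vs + ∑ (λ v → countEq v xs * h v) vs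
    ≡⟨ ∑-+ _ _ vs ⟨
  ∑ (λ v → 𝟙 (y ≟ v) * h v + countEq v xs * h v) vs
    ≡⟨ ∑-cong vs (λ {v} _ → sym (trans (cong (_* h v) (countEq-∷ v y xs))
                                       (*-distribʳ-+ (h v) (𝟙 (y ≟ v)) (countEq v xs)))) ⟩
  ∑ (λ v → countEq v (y ∷ xs) * h v) vs ∎
  where open ≡-Reasoning

module _ {A : Set} where

  replaceAt : List A → ℕ → A → List A
  replaceAt []       i       x = []
  replaceAt (y ∷ ys) zero    x = x ∷ ys
  replaceAt (y ∷ ys) (suc i) x = y ∷ replaceAt ys i x

  indexOr : A → List A → ℕ → A
  indexOr d []       i       = d
  indexOr d (y ∷ ys) zero    = y
  indexOr d (y ∷ ys) (suc i) = indexOr d ys i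

  length-replaceAt : ∀ (xs : List A) i x → length (replaceAt xs i x) ≡ length xs
  length-replaceAt []       i       x = refl
  length-replaceAt (y ∷ ys) zero    x = refl
  length-replaceAt (y ∷ ys) (suc i) x = cong suc (length-replaceAt ys i x)

  replaceAt-beyond : ∀ (xs : List A) {i} x → length xs ≤ i → replaceAt xs i x ≡ xs
  replaceAt-beyond []       x _         = refl
  replaceAt-beyond (y ∷ ys) x (s≤s ∣ys∣≤i) = cong (y ∷_) (replaceAt-beyond ys x ∣ys∣≤i)

  indexOr-beyond : ∀ d (xs : List A) {i} → length xs ≤ i → indexOr d xs i ≡ d
  indexOr-beyond d []       _            = refl
  indexOr-beyond d (y ∷ ys) (s≤s ∣ys∣≤i) = indexOr-beyond d ys ∣ys∣≤i

  replaceAt-++ : ∀ (as : List A) y bs x → replaceAt (as ++ y ∷ bs) (length as) x ≡ as ++ x ∷ bs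
  replaceAt-++ []       y bs x = refl
  replaceAt-++ (a ∷ as) y bs x = cong (a ∷_) (replaceAt-++ as y bs x)

  indexOr-++ : ∀ d (as : List A) y bs → indexOr d (as ++ y ∷ bs) (length as) ≡ y
  indexOr-++ d []       y bs = refl
  indexOr-++ d (a ∷ as) y bs = indexOr-++ d as y bs

  indexOr-∈ : ∀ d (xs : List A) {i} → i < length xs → indexOr d xs i ∈ xs
  indexOr-∈ d (y ∷ ys) {zero}  _           = here refl
  indexOr-∈ d (y ∷ ys) {suc i} (s≤s i<∣ys∣) = there (indexOr-∈ d ys i<∣ys∣)

  All-indexOr : ∀ {P : A → Set} {d} xs i → All P xs → P d → P (indexOr d xs i)
  All-indexOr []       i       []         Pd = Pd
  All-indexOr (y ∷ ys) zero    (Py ∷ _)   Pd = Py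
  All-indexOr (y ∷ ys) (suc i) (_ ∷ Pys)  Pd = All-indexOr ys i Pys Pd

  map-indexOr-upTo : ∀ d (xs : List A) → map (indexOr d xs) (upTo (length xs)) ≡ xs
  map-indexOr-upTo d xs = trans (map-upTo (indexOr d xs) (length xs)) (applyUpTo-indexOr xs)
    where
    applyUpTo-indexOr : ∀ xs → applyUpTo (indexOr d xs) (length xs) ≡ xs
    applyUpTo-indexOr []       = refl
    applyUpTo-indexOr (x ∷ xs) = cong (x ∷_) (applyUpTo-indexOr xs)

  replaceAt-∷ʳ-↭ : ∀ (xs : List A) i x → replaceAt xs i x ∷ʳ indexOr x xs i ↭ x ∷ xs
  replaceAt-∷ʳ-↭ []       i       x = ↭-refl
  replaceAt-∷ʳ-↭ (y ∷ ys) zero    x = ↭-prep x (↭-sym (∷↭∷ʳ y ys))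
  replaceAt-∷ʳ-↭ (y ∷ ys) (suc i) x = ↭-trans (↭-prep y (replaceAt-∷ʳ-↭ ys i x)) (↭-swap y x ↭-refl)

  replaceAt-injective : ∀ {x d : A} (xs ys : List A) {i j} → x ∉ xs → x ∉ ys →
    length xs ≡ length ys → i ≤ length xs → j ≤ length ys →
    replaceAt xs i x ≡ replaceAt ys j x → indexOr d xs i ≡ indexOr d ys j → xs ≡ ys × i ≡ j
  replaceAt-injective [] [] _ _ _ z≤n z≤n _ _ = refl , refl
  replaceAt-injective (x′ ∷ xs) (y′ ∷ ys) {zero} {zero} _ _ _ _ _ eq x′≡y′ =
    cong₂ _∷_ x′≡y′ (proj₂ (∷-injective eq)) , refl
  replaceAt-injective (x′ ∷ xs) (y′ ∷ ys) {zero} {suc j} _ x∉ys _ _ _ eq _ =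
    contradiction (here (proj₁ (∷-injective eq))) x∉ys
  replaceAt-injective (x′ ∷ xs) (y′ ∷ ys) {suc i} {zero} x∉xs _ _ _ _ eq _ =
    contradiction (here (sym (proj₁ (∷-injective eq)))) x∉xs
  replaceAt-injective (x′ ∷ xs) (y′ ∷ ys) {suc i} {suc j}
                      x∉xs x∉ys ∣xs∣≡∣ys∣ (s≤s i≤) (s≤s j≤) eq₁ eq₂
    with x′≡y′ , eq₁′ ← ∷-injective eq₁
    with xs≡ys , i≡j ← replaceAt-injective xs ys (x∉xs ∘ there) (x∉ys ∘ there)
                         (suc-injective ∣xs∣≡∣ys∣) i≤ j≤ eq₁′ eq₂ =
    cong₂ _∷_ x′≡y′ xs≡ys , cong suc i≡j

countEq-replaceAt : ∀ v xs i x → countEq v (replaceAt xs i x) + 𝟙 (indexOr x xs i ≟ v) ≡ 𝟙 (x ≟ v) + countEq v xs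
countEq-replaceAt v xs i x = begin
  countEq v (replaceAt xs i x) + 𝟙 (indexOr x xs i ≟ v) ≡⟨ countEq-∷ʳ v (replaceAt xs i x) (indexOr x xs i) ⟨
  countEq v (replaceAt xs i x ∷ʳ indexOr x xs i)        ≡⟨ countEq-↭ v (replaceAt-∷ʳ-↭ xs i x) ⟩
  countEq v (x ∷ xs)                                    ≡⟨ countEq-∷ v x xs ⟩
  𝟙 (x ≟ v) + countEq v xs                              ∎
  where open ≡-Reasoning

-- Permutations and their one-point extensions

record IsPermutation (m : ℕ) (σ : List ℕ) : Set where
  field
    length≡ : length σ ≡ m
    bounded : All (_< m) σ
    unique  : Unique σ

open IsPermutation

max∉ : ∀ {m π} → IsPermutation m π → m ∉ π
max∉ π-perm m∈π = <-irrefl refl (All.lookup (bounded π-perm) m∈π)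

max∈ : ∀ {m σ} → IsPermutation (suc m) σ → m ∈ σ
max∈ {m} {σ} σ-perm with m ∈? σ
... | yes m∈σ = m∈σ
... | no  m∉σ = contradiction (subst (_≤ m) (length≡ σ-perm) (pigeonhole (unique σ-perm) σ<m)) (n≮n m)
  where
  σ<m : All (_< m) σ
  σ<m = All.tabulate (λ v∈σ → ≤∧≢⇒< (s≤s⁻¹ (All.lookup (bounded σ-perm) v∈σ))
                                     (λ v≡m → m∉σ (subst (_∈ σ) v≡m v∈σ)))

isPermutation-resp-↭ : ∀ {m σ τ} → σ ↭ τ → IsPermutation m σ → IsPermutation m τ
isPermutation-resp-↭ σ↭τ σ-perm = record
  { length≡ = trans (sym (↭-length σ↭τ)) (length≡ σ-perm)
  ; bounded = All-resp-↭ σ↭τ (bounded σ-perm)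
  ; unique  = Unique-resp-↭ (↭⇒↭ₛ σ↭τ) (unique σ-perm)
  }

isPermutation-∷ : ∀ {m π} → IsPermutation m π → IsPermutation (suc m) (m ∷ π)
isPermutation-∷ π-perm = record
  { length≡ = cong suc (length≡ π-perm)
  ; bounded = ≤-refl ∷ All.map m<n⇒m<1+n (bounded π-perm)
  ; unique  = All.map (λ v<m m≡v → <-irrefl (sym m≡v) v<m) (bounded π-perm) ∷ unique π-perm
  }

isPermutation-∷⁻ : ∀ {m π} → IsPermutation (suc m) (m ∷ π) → IsPermutation m π
isPermutation-∷⁻ {m} {π} σ-perm with _ ∷ π<1+m ← bounded σ-perm | m∉π ∷ π! ← unique σ-perm = record
  { length≡ = suc-injective (length≡ σ-perm)
  ; bounded = All.tabulate (λ v∈π → ≤∧≢⇒< (s≤s⁻¹ (All.lookup π<1+m v∈π))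
                                          (λ v≡m → All.lookup m∉π v∈π (sym v≡m)))
  ; unique  = π!
  }

-- For i = m, replaceAt does nothing and indexOr falls back to m, so m is appended.
extend : ℕ → List ℕ → ℕ → List ℕ
extend m π i = replaceAt π i m ∷ʳ indexOr m π i

module _ {m : ℕ} where

  extend-isPermutation : ∀ {π i} → IsPermutation m π → IsPermutation (suc m) (extend m π i)
  extend-isPermutation {π} {i} π-perm =
    isPermutation-resp-↭ (↭-sym (replaceAt-∷ʳ-↭ π i m)) (isPermutation-∷ π-perm)

  extend-isPermutation⁻ : ∀ {π i} → IsPermutation (suc m) (extend m π i) → IsPermutation m π
  extend-isPermutation⁻ {π} {i} σ-perm =
    isPermutation-∷⁻ (isPermutation-resp-↭ (replaceAt-∷ʳ-↭ π i m) σ-perm)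

  extend-injective : ∀ {π π′ i j} → IsPermutation m π → IsPermutation m π′ → i ≤ m → j ≤ m →
    extend m π i ≡ extend m π′ j → π ≡ π′ × i ≡ j
  extend-injective {π} {π′} {i} {j} π-perm π′-perm i≤m j≤m eq
    with eq₁ , eq₂ ← ∷ʳ-injective (replaceAt π i m) (replaceAt π′ j m) eq =
    replaceAt-injective π π′ (max∉ π-perm) (max∉ π′-perm)
      (trans (length≡ π-perm) (sym (length≡ π′-perm)))
      (subst (i ≤_) (sym (length≡ π-perm)) i≤m) (subst (j ≤_) (sym (length≡ π′-perm)) j≤m) eq₁ eq₂

  ∈⇒≡extend : ∀ {σ} → m ∈ σ → ∃₂ λ π i → i ≤ length π × extend m π i ≡ σ
  ∈⇒≡extend m∈σ with ∈-∃++ m∈σ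
  ... | as , cs , refl with initLast cs
  ...   | [] = as , length as , ≤-refl ,
                cong₂ _∷ʳ_ (replaceAt-beyond as m ≤-refl) (indexOr-beyond m as ≤-refl)
  ...   | cs′ ∷ʳ′ y = as ++ y ∷ cs′ , length as ,
                subst (length as ≤_) (sym (length-++ as)) (m≤m+n (length as) _) ,
                trans (cong₂ _∷ʳ_ (replaceAt-++ as y cs′ m) (indexOr-++ m as y cs′))
                      (++-assoc as (m ∷ cs′) [ y ])

  extend-surjective : ∀ {σ} → IsPermutation (suc m) σ →
    ∃₂ λ π i → IsPermutation m π × i ≤ m × extend m π i ≡ σ
  extend-surjective σ-perm with ∈⇒≡extend (max∈ σ-perm)
  ... | π , i , i≤∣π∣ , refl = π , i , π-perm , subst (i ≤_) (length≡ π-perm) i≤∣π∣ , refl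
    where
    π-perm = extend-isPermutation⁻ σ-perm

-- The enumeration Sn

concatMap-map≡cartesianProductWith : {A B C : Set} (f : A → B → C) (xs : List A) (ys : List B) →
  concatMap (λ x → map (f x) ys) xs ≡ cartesianProductWith f xs ys
concatMap-map≡cartesianProductWith f []       ys = refl
concatMap-map≡cartesianProductWith f (x ∷ xs) ys =
  cong (map (f x) ys ++_) (concatMap-map≡cartesianProductWith f xs ys)

module _ (n : ℕ) where

  words-suc : ∀ m → words n (suc m) ≡ cartesianProductWith _∷_ (upTo n) (words n m)
  words-suc m = concatMap-map≡cartesianProductWith _∷_ (upTo n) (words n m)

  ∈-words⁻ : ∀ m {w} → w ∈ words n m → length w ≡ m × All (_< n) w
  ∈-words⁻ zero    (here refl) = refl , []
  ∈-words⁻ (suc m) w∈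
    with x , w′ , x∈ , w′∈ , refl ← ∈-cartesianProductWith⁻ _∷_ (upTo n) (words n m)
                                       (subst (_ ∈_) (words-suc m) w∈)
    with ∣w′∣ , w′<n ← ∈-words⁻ m w′∈ = cong suc ∣w′∣ , ∈-upTo⁻ x∈ ∷ w′<n

  ∈-words⁺ : ∀ {w} → All (_< n) w → w ∈ words n (length w)
  ∈-words⁺ []              = here refl
  ∈-words⁺ {x ∷ w} (x<n ∷ w<n) =
    subst (_ ∈_) (sym (words-suc (length w))) (∈-cartesianProductWith⁺ _∷_ (∈-upTo⁺ x<n) (∈-words⁺ w<n))

  words-unique : ∀ m → Unique (words n m)
  words-unique zero    = [] ∷ []
  words-unique (suc m) = subst Unique (sym (words-suc m))
    (Unique.cartesianProductWith⁺ _∷_ ∷-injective (Unique.upTo⁺ n) (words-unique m))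

elemᵇ≡false⇒∉ : ∀ {x} xs → elemᵇ x xs ≡ false → x ∉ xs
elemᵇ≡false⇒∉ xs e x∈xs = case trans (sym (Equivalence.to T-≡ (any⁺ _ (Any.map (≡⇒≡ᵇ _ _) x∈xs)))) e of λ ()

∉⇒elemᵇ≡false : ∀ {x} xs → x ∉ xs → elemᵇ x xs ≡ false
∉⇒elemᵇ≡false xs x∉xs = ¬-not (x∉xs ∘ Any.map (≡ᵇ⇒≡ _ _) ∘ any⁻ _ xs ∘ Equivalence.from T-≡)

distinctᵇ⇒unique : ∀ xs → distinctᵇ xs ≡ true → Unique xs
distinctᵇ⇒unique []       _ = []
distinctᵇ⇒unique (x ∷ xs) _ with elemᵇ x xs in x∈?xs | distinctᵇ xs in d
distinctᵇ⇒unique (x ∷ xs) () | true  | _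
distinctᵇ⇒unique (x ∷ xs) () | false | false
... | false | true =
  All.tabulate (λ y∈xs x≡y → elemᵇ≡false⇒∉ xs x∈?xs (subst (_∈ xs) (sym x≡y) y∈xs)) ∷ distinctᵇ⇒unique xs d

unique⇒distinctᵇ : ∀ {xs} → Unique xs → distinctᵇ xs ≡ true
unique⇒distinctᵇ []                 = refl
unique⇒distinctᵇ {x ∷ xs} (x∉xs ∷ xs!)
  rewrite ∉⇒elemᵇ≡false xs (Unique.Unique[x∷xs]⇒x∉xs (x∉xs ∷ xs!)) | unique⇒distinctᵇ xs! = refl

∈-Sn⁻ : ∀ {n σ} → σ ∈ Sn n → IsPermutation n σ
∈-Sn⁻ {n} σ∈
  with σ∈words , distinct ← ∈-filter⁻ (λ w → distinctᵇ w Bool.≟ true) {xs = words n n} σ∈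
  with ∣σ∣ , σ<n ← ∈-words⁻ n n σ∈words =
  record { length≡ = ∣σ∣ ; bounded = σ<n ; unique = distinctᵇ⇒unique _ distinct }

∈-Sn⁺ : ∀ {n σ} → IsPermutation n σ → σ ∈ Sn n
∈-Sn⁺ {n} σ-perm = ∈-filter⁺ (λ w → distinctᵇ w Bool.≟ true)
  (subst (λ k → _ ∈ words n k) (length≡ σ-perm) (∈-words⁺ n (bounded σ-perm)))
  (unique⇒distinctᵇ (unique σ-perm))

Sn-unique : ∀ n → Unique (Sn n)
Sn-unique n = Unique.filter⁺ _ (words-unique n n)

extensions : ℕ → List (List ℕ)
extensions m = cartesianProductWith (extend m) (Sn m) (upTo (suc m))

Sn-suc↭extensions : ∀ m → Sn (suc m) ↭ extensions m
Sn-suc↭extensions m = unique∧set⇒↭ (Sn-unique (suc m)) extensions-unique (mk⇔ to from)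
  where
  extensions-unique : Unique (extensions m)
  extensions-unique = cartesianProductWith-unique (extend m) (Sn-unique m) (Unique.upTo⁺ (suc m))
    (λ π∈ π′∈ i∈ j∈ → extend-injective (∈-Sn⁻ π∈) (∈-Sn⁻ π′∈)
                                        (s≤s⁻¹ (∈-upTo⁻ i∈)) (s≤s⁻¹ (∈-upTo⁻ j∈)))
  to : ∀ {σ} → σ ∈ Sn (suc m) → σ ∈ extensions m
  to σ∈ with π , i , π-perm , i≤m , refl ← extend-surjective {m} (∈-Sn⁻ σ∈) =
    ∈-cartesianProductWith⁺ (extend m) (∈-Sn⁺ π-perm) (∈-upTo⁺ (s≤s i≤m))
  from : ∀ {σ} → σ ∈ extensions m → σ ∈ Sn (suc m)
  from σ∈ with π , i , π∈ , _ , refl ← ∈-cartesianProductWith⁻ (extend m) (Sn m) (upTo (suc m)) σ∈ =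
    ∈-Sn⁺ (extend-isPermutation (∈-Sn⁻ π∈))

-- Levels

levelsFrom : ℕ → List ℕ → List ℕ
levelsFrom s []       = []
levelsFrom s (x ∷ xs) = (s ⊔ x) ∷ levelsFrom (suc s) xs

levels≡levelsFrom : ∀ π → levels π ≡ levelsFrom 0 π
levels≡levelsFrom π = go 0 (λ j → j) (λ _ → refl) π
  where
  go : ∀ s (f : ℕ → ℕ) → (∀ j → f j ≡ s + j) → ∀ xs →
    map (λ p → proj₁ p ⊔ proj₂ p) (zip (applyUpTo f (length xs)) xs) ≡ levelsFrom s xs
  go s f f≗s+ []       = refl
  go s f f≗s+ (x ∷ xs) = cong₂ _∷_ (cong (_⊔ x) (trans (f≗s+ 0) (+-identityʳ s)))
    (go (suc s) (f ∘ suc) (λ j → trans (f≗s+ (suc j)) (+-suc s j)) xs)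

levelsFrom-∷ʳ : ∀ s xs y → levelsFrom s (xs ∷ʳ y) ≡ levelsFrom s xs ∷ʳ ((s + length xs) ⊔ y)
levelsFrom-∷ʳ s []       y = cong (λ t → t ⊔ y ∷ []) (sym (+-identityʳ s))
levelsFrom-∷ʳ s (x ∷ xs) y = cong ((s ⊔ x) ∷_) (trans (levelsFrom-∷ʳ (suc s) xs y)
  (cong (λ t → levelsFrom (suc s) xs ∷ʳ (t ⊔ y)) (sym (+-suc s (length xs)))))

levelsFrom-replaceAt : ∀ s xs i x → levelsFrom s (replaceAt xs i x) ≡ replaceAt (levelsFrom s xs) i ((s + i) ⊔ x)
levelsFrom-replaceAt s []       i       x = refl
levelsFrom-replaceAt s (y ∷ ys) zero    x = cong (λ t → t ⊔ x ∷ levelsFrom (suc s) ys) (sym (+-identityʳ s))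
levelsFrom-replaceAt s (y ∷ ys) (suc i) x = cong ((s ⊔ y) ∷_) (trans (levelsFrom-replaceAt (suc s) ys i x)
  (cong (λ t → replaceAt (levelsFrom (suc s) ys) i (t ⊔ x)) (sym (+-suc s i))))

length-levelsFrom : ∀ s xs → length (levelsFrom s xs) ≡ length xs
length-levelsFrom s []       = refl
length-levelsFrom s (x ∷ xs) = cong suc (length-levelsFrom (suc s) xs)

levelsFrom-bounded : ∀ {m} s xs → s + length xs ≤ m → All (_< m) xs → All (_< m) (levelsFrom s xs)
levelsFrom-bounded     s []       _    []           = []
levelsFrom-bounded {m} s (x ∷ xs) s+∣x∷xs∣≤m (x<m ∷ xs<m) =
  ⊔-lub s<m x<m ∷ levelsFrom-bounded (suc s) xs 1+s+∣xs∣≤m xs<m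
  where
  1+s+∣xs∣≤m : suc s + length xs ≤ m
  1+s+∣xs∣≤m = subst (_≤ m) (+-suc s (length xs)) s+∣x∷xs∣≤m
  s<m : s < m
  s<m = ≤-trans (s≤s (m≤m+n s (length xs))) 1+s+∣xs∣≤m

𝟙-⊔ : ∀ s x v → 𝟙 (s ⊔ x ≟ v) ≤ 𝟙 (s ≟ v) + 𝟙 (x ≟ v)
𝟙-⊔ s x v with ⊔-sel s x
... | inj₁ s⊔x≡s = ≤-trans (𝟙-mono (s ⊔ x ≟ v) (s ≟ v) (trans (sym s⊔x≡s))) (m≤m+n _ (𝟙 (x ≟ v)))
... | inj₂ s⊔x≡x = ≤-trans (𝟙-mono (s ⊔ x ≟ v) (x ≟ v) (trans (sym s⊔x≡x))) (m≤n+m _ (𝟙 (s ≟ v)))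

𝟙-≤-split : ∀ s v → 𝟙 (s ≟ v) + 𝟙 (suc s ≤? v) ≡ 𝟙 (s ≤? v)
𝟙-≤-split s v with <-cmp s v
... | tri< s<v s≢v _
  rewrite 𝟙-no (s ≟ v) s≢v | 𝟙-yes (suc s ≤? v) s<v | 𝟙-yes (s ≤? v) (<⇒≤ s<v) = refl
... | tri≈ _ refl _
  rewrite 𝟙-yes (s ≟ s) refl | 𝟙-no (suc s ≤? s) (n≮n s) | 𝟙-yes (s ≤? s) ≤-refl = refl
... | tri> _ s≢v v<s
  rewrite 𝟙-no (s ≟ v) s≢v | 𝟙-no (suc s ≤? v) (<⇒≱ (m<n⇒m<1+n v<s)) | 𝟙-no (s ≤? v) (<⇒≱ v<s) = refl

countEq-levelsFrom : ∀ v s xs → countEq v (levelsFrom s xs) ≤ 𝟙 (s ≤? v) + countEq v xs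
countEq-levelsFrom v s []       = z≤n
countEq-levelsFrom v s (x ∷ xs) = begin
  countEq v ((s ⊔ x) ∷ levelsFrom (suc s) xs)        ≡⟨ countEq-∷ v (s ⊔ x) _ ⟩
  𝟙 (s ⊔ x ≟ v) + countEq v (levelsFrom (suc s) xs)  ≤⟨ +-mono-≤ (𝟙-⊔ s x v) (countEq-levelsFrom v (suc s) xs) ⟩
  (𝟙 (s ≟ v) + 𝟙 (x ≟ v)) + (𝟙 (suc s ≤? v) + countEq v xs)
    ≡⟨ interchange (𝟙 (s ≟ v)) (𝟙 (x ≟ v)) (𝟙 (suc s ≤? v)) (countEq v xs) ⟩
  (𝟙 (s ≟ v) + 𝟙 (suc s ≤? v)) + (𝟙 (x ≟ v) + countEq v xs)
    ≡⟨ cong₂ _+_ (𝟙-≤-split s v) (sym (countEq-∷ v x xs)) ⟩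
  𝟙 (s ≤? v) + countEq v (x ∷ xs)                    ∎
  where open ≤-Reasoning

module _ {m π} (π-perm : IsPermutation m π) where

  length-levels : length (levels π) ≡ m
  length-levels = trans (cong length (levels≡levelsFrom π)) (trans (length-levelsFrom 0 π) (length≡ π-perm))

  levels-bounded : All (_< m) (levels π)
  levels-bounded = subst (All (_< m)) (sym (levels≡levelsFrom π))
    (levelsFrom-bounded 0 π (≤-reflexive (length≡ π-perm)) (bounded π-perm))

  countEq-levels≤2 : ∀ v → countEq v (levels π) ≤ 2
  countEq-levels≤2 v = begin
    countEq v (levels π)       ≡⟨ cong (countEq v) (levels≡levelsFrom π) ⟩
    countEq v (levelsFrom 0 π) ≤⟨ countEq-levelsFrom v 0 π ⟩
    𝟙 (0 ≤? v) + countEq v π   ≤⟨ +-mono-≤ (𝟙≤1 (0 ≤? v)) (Unique⇒countEq≤1 v (unique π-perm)) ⟩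
    2                          ∎
    where open ≤-Reasoning

  levels-extend : ∀ {i} → i ≤ m → levels (extend m π i) ≡ replaceAt (levels π) i m ∷ʳ m
  levels-extend {i} i≤m = begin
    levels (extend m π i)
      ≡⟨ levels≡levelsFrom (extend m π i) ⟩
    levelsFrom 0 (replaceAt π i m ∷ʳ indexOr m π i)
      ≡⟨ levelsFrom-∷ʳ 0 (replaceAt π i m) (indexOr m π i) ⟩
    levelsFrom 0 (replaceAt π i m) ∷ʳ (length (replaceAt π i m) ⊔ indexOr m π i)
      ≡⟨ cong₂ _∷ʳ_ (levelsFrom-replaceAt 0 π i m)
                     (cong (_⊔ indexOr m π i) (trans (length-replaceAt π i m) (length≡ π-perm))) ⟩
    replaceAt (levelsFrom 0 π) i (i ⊔ m) ∷ʳ (m ⊔ indexOr m π i)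
      ≡⟨ cong₂ (λ L x → replaceAt L i x ∷ʳ (m ⊔ indexOr m π i))
               (levels≡levelsFrom π) (sym (m≤n⇒m⊔n≡n i≤m)) ⟨
    replaceAt (levels π) i m ∷ʳ (m ⊔ indexOr m π i)
      ≡⟨ cong (replaceAt (levels π) i m ∷ʳ_)
              (m≥n⇒m⊔n≡m (All-indexOr π i (All.map <⇒≤ (bounded π-perm)) ≤-refl)) ⟩
    replaceAt (levels π) i m ∷ʳ m ∎
    where open ≡-Reasoning

double? : (L : List ℕ) (v : ℕ) → Dec (countEq v L ≡ 2)
double? L v = countEq v L ≟ 2

doubles : ℕ → List ℕ → ℕ
doubles m L = length (filter (double? L) (upTo m))

doubles-suc : ∀ m L → doubles (suc m) L ≡ doubles m L + 𝟙 (double? L m)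
doubles-suc m L = begin
  length (filter (double? L) (upTo (suc m)))
    ≡⟨ cong (length ∘ filter (double? L)) (upTo-∷ʳ m) ⟨
  length (filter (double? L) (upTo m ++ [ m ]))
    ≡⟨ cong length (filter-++ (double? L) (upTo m) [ m ]) ⟩
  length (filter (double? L) (upTo m) ++ filter (double? L) [ m ])
    ≡⟨ length-++ (filter (double? L) (upTo m)) ⟩
  doubles m L + length (filter (double? L) [ m ])
    ≡⟨ cong (doubles m L +_) (trans (length-filter≡∑𝟙 (double? L) [ m ]) (+-identityʳ _)) ⟩
  doubles m L + 𝟙 (double? L m) ∎
  where open ≡-Reasoning

doubles≡∑ : ∀ m L → doubles m L ≡ ∑ (𝟙 ∘ double? L) (upTo m)
doubles≡∑ m L = length-filter≡∑𝟙 (double? L) (upTo m)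

doubles-cong : ∀ {m L L′} → (∀ {v} → v < m → countEq v L ≡ countEq v L′) → doubles m L ≡ doubles m L′
doubles-cong {m} {L} {L′} same = begin
  doubles m L                     ≡⟨ doubles≡∑ m L ⟩
  ∑ (𝟙 ∘ double? L) (upTo m)      ≡⟨ ∑-cong (upTo m) (cong (λ c → 𝟙 (c ≟ 2)) ∘ same ∘ ∈-upTo⁻) ⟩
  ∑ (𝟙 ∘ double? L′) (upTo m)     ≡⟨ doubles≡∑ m L′ ⟨
  doubles m L′                    ∎
  where open ≡-Reasoning

doubles-∷ʳ : ∀ {m L} → All (_< m) L → doubles (suc m) (L ∷ʳ m) ≡ doubles m L
doubles-∷ʳ {m} {L} L<m = begin
  doubles (suc m) (L ∷ʳ m)                        ≡⟨ doubles-suc m (L ∷ʳ m) ⟩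
  doubles m (L ∷ʳ m) + 𝟙 (double? (L ∷ʳ m) m)   ≡⟨ cong₂ _+_ (doubles-cong {L = L ∷ʳ m} {L′ = L} count<m)
                                                             (cong (λ c → 𝟙 (c ≟ 2)) count-m) ⟩
  doubles m L + 0                                 ≡⟨ +-identityʳ _ ⟩
  doubles m L                                     ∎
  where
  open ≡-Reasoning
  count<m : ∀ {v} → v < m → countEq v (L ∷ʳ m) ≡ countEq v L
  count<m {v} v<m = trans (countEq-∷ʳ v L m)
    (trans (cong (countEq v L +_) (𝟙-no (m ≟ v) (λ m≡v → <-irrefl (sym m≡v) v<m))) (+-identityʳ _))
  count-m : countEq m (L ∷ʳ m) ≡ 1
  count-m = trans (countEq-∷ʳ m L m)
    (cong₂ _+_ (countEq-∉ (λ m∈L → <-irrefl refl (All.lookup L<m m∈L))) (𝟙-yes (m ≟ m) refl))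

module _ {m : ℕ} {L : List ℕ} {i : ℕ} (L<m : All (_< m) L) (i<∣L∣ : i < length L) where

  private
    ℓ = indexOr m L i
    ℓ<m : ℓ < m
    ℓ<m = All.lookup L<m (indexOr-∈ m L i<∣L∣)
    m≢ℓ : m ≢ ℓ
    m≢ℓ m≡ℓ = <-irrefl (sym m≡ℓ) ℓ<m
    cᵣ : ℕ → ℕ
    cᵣ v = countEq v (replaceAt L i m)
    open ≡-Reasoning

  countEq-replaceAt-∷ʳ-max : countEq m (replaceAt L i m ∷ʳ m) ≡ 2
  countEq-replaceAt-∷ʳ-max = begin
    countEq m (replaceAt L i m ∷ʳ m) ≡⟨ countEq-∷ʳ m (replaceAt L i m) m ⟩
    cᵣ m + 𝟙 (m ≟ m)                  ≡⟨ cong₂ _+_ (sym (+-identityʳ (cᵣ m))) (𝟙-yes (m ≟ m) refl) ⟩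
    cᵣ m + 0 + 1                      ≡⟨ cong (λ b → cᵣ m + b + 1) (𝟙-no (ℓ ≟ m) (m≢ℓ ∘ sym)) ⟨
    cᵣ m + 𝟙 (ℓ ≟ m) + 1              ≡⟨ cong (_+ 1) (countEq-replaceAt m L i m) ⟩
    𝟙 (m ≟ m) + countEq m L + 1      ≡⟨ cong₂ (λ a b → a + b + 1) (𝟙-yes (m ≟ m) refl) (countEq-∉ m∉L) ⟩
    2                                ∎
    where
    m∉L : m ∉ L
    m∉L m∈L = <-irrefl refl (All.lookup L<m m∈L)

  countEq-replaceAt-∷ʳ-moved : countEq ℓ (replaceAt L i m ∷ʳ m) + 1 ≡ countEq ℓ L
  countEq-replaceAt-∷ʳ-moved = begin
    countEq ℓ (replaceAt L i m ∷ʳ m) + 1 ≡⟨ cong (_+ 1) (countEq-∷ʳ ℓ (replaceAt L i m) m) ⟩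
    cᵣ ℓ + 𝟙 (m ≟ ℓ) + 1                  ≡⟨ cong (λ b → cᵣ ℓ + b + 1) (𝟙-no (m ≟ ℓ) m≢ℓ) ⟩
    cᵣ ℓ + 0 + 1                          ≡⟨ cong₂ _+_ (+-identityʳ (cᵣ ℓ)) (sym (𝟙-yes (ℓ ≟ ℓ) refl)) ⟩
    cᵣ ℓ + 𝟙 (ℓ ≟ ℓ)                      ≡⟨ countEq-replaceAt ℓ L i m ⟩
    𝟙 (m ≟ ℓ) + countEq ℓ L              ≡⟨ cong (_+ countEq ℓ L) (𝟙-no (m ≟ ℓ) m≢ℓ) ⟩
    countEq ℓ L                          ∎

  countEq-replaceAt-∷ʳ-other : ∀ {v} → v < m → v ≢ ℓ → countEq v (replaceAt L i m ∷ʳ m) ≡ countEq v L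
  countEq-replaceAt-∷ʳ-other {v} v<m v≢ℓ = begin
    countEq v (replaceAt L i m ∷ʳ m) ≡⟨ countEq-∷ʳ v (replaceAt L i m) m ⟩
    cᵣ v + 𝟙 (m ≟ v)                  ≡⟨ cong (cᵣ v +_) (trans m≠v (sym (𝟙-no (ℓ ≟ v) (v≢ℓ ∘ sym)))) ⟩
    cᵣ v + 𝟙 (ℓ ≟ v)                  ≡⟨ countEq-replaceAt v L i m ⟩
    𝟙 (m ≟ v) + countEq v L          ≡⟨ cong (_+ countEq v L) m≠v ⟩
    countEq v L                      ∎
    where
    m≠v : 𝟙 (m ≟ v) ≡ 0
    m≠v = 𝟙-no (m ≟ v) (λ m≡v → <-irrefl (sym m≡v) v<m)

  doubles-replaceAt-∷ʳ : countEq ℓ L ≤ 2 →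
    doubles (suc m) (replaceAt L i m ∷ʳ m) + 𝟙 (double? L ℓ) ≡ suc (doubles m L)
  doubles-replaceAt-∷ʳ count-ℓ≤2 = begin
    doubles (suc m) N + 𝟙 (double? L ℓ)              ≡⟨ cong (_+ 𝟙 (double? L ℓ)) (doubles-suc m N) ⟩
    doubles m N + 𝟙 (double? N m) + 𝟙 (double? L ℓ)  ≡⟨ cong (λ c → doubles m N + 𝟙 (c ≟ 2) + 𝟙 (double? L ℓ))
                                                              countEq-replaceAt-∷ʳ-max ⟩
    doubles m N + 1 + 𝟙 (double? L ℓ)                ≡⟨ cong (_+ 𝟙 (double? L ℓ)) (+-comm (doubles m N) 1) ⟩
    suc (doubles m N + 𝟙 (double? L ℓ))              ≡⟨ cong suc exchange ⟩
    suc (doubles m L + 𝟙 (double? N ℓ))              ≡⟨ cong (λ c → suc (doubles m L + c)) (𝟙-no (double? N ℓ) moved≢2) ⟩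
    suc (doubles m L + 0)                            ≡⟨ cong suc (+-identityʳ _) ⟩
    suc (doubles m L)                                ∎
    where
    N = replaceAt L i m ∷ʳ m
    moved≢2 : countEq ℓ N ≢ 2
    moved≢2 c≡2 = n≮n 2 (subst (λ c → c + 1 ≤ 2) c≡2
                               (subst (_≤ 2) (sym countEq-replaceAt-∷ʳ-moved) count-ℓ≤2))
    exchange : doubles m N + 𝟙 (double? L ℓ) ≡ doubles m L + 𝟙 (double? N ℓ)
    exchange = begin
      doubles m N + 𝟙 (double? L ℓ)              ≡⟨ cong (_+ 𝟙 (double? L ℓ)) (doubles≡∑ m N) ⟩
      ∑ (𝟙 ∘ double? N) (upTo m) + 𝟙 (double? L ℓ)
        ≡⟨ ∑-update {𝟙 ∘ double? N} {𝟙 ∘ double? L} (Unique.upTo⁺ m) (∈-upTo⁺ ℓ<m)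
             (λ v∈ v≢ℓ → cong (λ c → 𝟙 (c ≟ 2)) (countEq-replaceAt-∷ʳ-other (∈-upTo⁻ v∈) v≢ℓ)) ⟩
      ∑ (𝟙 ∘ double? L) (upTo m) + 𝟙 (double? N ℓ) ≡⟨ cong (_+ 𝟙 (double? N ℓ)) (doubles≡∑ m L) ⟨
      doubles m L + 𝟙 (double? N ℓ)              ∎

length-filter-double? : ∀ {m L} → All (_< m) L → length (filter (double? L) L) ≡ 2 * doubles m L
length-filter-double? {m} {L} L<m = begin
  length (filter (double? L) L)                        ≡⟨ length-filter≡∑𝟙 (double? L) L ⟩
  ∑ (𝟙 ∘ double? L) L                                  ≡⟨ ∑-byValue _ (Unique.upTo⁺ m) L (All.map ∈-upTo⁺ L<m) ⟩
  ∑ (λ v → countEq v L * 𝟙 (double? L v)) (upTo m)     ≡⟨ ∑-cong (upTo m) (λ {v} _ → twice (countEq v L)) ⟩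
  ∑ (λ v → 2 * 𝟙 (double? L v)) (upTo m)               ≡⟨ ∑-*ˡ 2 (𝟙 ∘ double? L) (upTo m) ⟩
  2 * ∑ (𝟙 ∘ double? L) (upTo m)                       ≡⟨ cong (2 *_) (doubles≡∑ m L) ⟨
  2 * doubles m L                                      ∎
  where
  open ≡-Reasoning
  twice : ∀ c → c * 𝟙 (c ≟ 2) ≡ 2 * 𝟙 (c ≟ 2)
  twice c with c ≟ 2
  ... | yes refl = refl
  ... | no  _    = *-zeroʳ c

-- Doubled levels of the extensions of a permutation

2d𝟙[d≡k]+x+𝟙[d≡k] : ∀ d k x → 2 * d * 𝟙 (d ≟ k) + x + 𝟙 (d ≟ k) ≡ (2 * k + 1) * 𝟙 (d ≟ k) + x
2d𝟙[d≡k]+x+𝟙[d≡k] d k x with d ≟ k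
... | yes refl = trans (cong (λ t → t + x + 1) (*-identityʳ (2 * d)))
                       (trans (xy∙z≈xz∙y (2 * d) x 1) (cong (_+ x) (sym (*-identityʳ (2 * d + 1)))))
... | no  _    = trans (+-identityʳ _) (cong (_+ x) (trans (*-zeroʳ (2 * d)) (sym (*-zeroʳ (2 * k + 1)))))

module _ {m π} (π-perm : IsPermutation m π) where

  private
    L = levels π
    d = doubleLevels π

  doubleLevels≡doubles : d ≡ doubles m L
  doubleLevels≡doubles = cong (λ n → doubles n L) (length≡ π-perm)

  doubleLevels-extend≡doubles : ∀ {i} → i ≤ m → doubleLevels (extend m π i) ≡ doubles (suc m) (replaceAt L i m ∷ʳ m)
  doubleLevels-extend≡doubles {i} i≤m =
    cong₂ doubles (trans (↭-length (replaceAt-∷ʳ-↭ π i m)) (cong suc (length≡ π-perm))) (levels-extend π-perm i≤m)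

  doubleLevels-extend-max : doubleLevels (extend m π m) ≡ d
  doubleLevels-extend-max = begin
    doubleLevels (extend m π m)           ≡⟨ doubleLevels-extend≡doubles ≤-refl ⟩
    doubles (suc m) (replaceAt L m m ∷ʳ m) ≡⟨ cong (λ L′ → doubles (suc m) (L′ ∷ʳ m))
                                                    (replaceAt-beyond L m (≤-reflexive (length-levels π-perm))) ⟩
    doubles (suc m) (L ∷ʳ m)              ≡⟨ doubles-∷ʳ (levels-bounded π-perm) ⟩
    doubles m L                           ≡⟨ doubleLevels≡doubles ⟨
    d                                     ∎
    where open ≡-Reasoning

  doubleLevels-extend : ∀ {i} → i < m → doubleLevels (extend m π i) + 𝟙 (double? L (indexOr m L i)) ≡ suc d
  doubleLevels-extend {i} i<m = begin
    doubleLevels (extend m π i) + 𝟙 (double? L (indexOr m L i))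
      ≡⟨ cong (_+ 𝟙 (double? L (indexOr m L i))) (doubleLevels-extend≡doubles (<⇒≤ i<m)) ⟩
    doubles (suc m) (replaceAt L i m ∷ʳ m) + 𝟙 (double? L (indexOr m L i))
      ≡⟨ doubles-replaceAt-∷ʳ (levels-bounded π-perm) (subst (i <_) (sym (length-levels π-perm)) i<m)
                              (countEq-levels≤2 π-perm (indexOr m L i)) ⟩
    suc (doubles m L)
      ≡⟨ cong suc doubleLevels≡doubles ⟨
    suc d ∎
    where open ≡-Reasoning

  length-filter-doubledLevels : length (filter (double? L) L) ≡ 2 * d
  length-filter-doubledLevels = trans (length-filter-double? (levels-bounded π-perm)) (cong (2 *_) (sym doubleLevels≡doubles))

  doubleLevels-bound : 2 * d ≤ m
  doubleLevels-bound = subst₂ _≤_ length-filter-doubledLevels (length-levels π-perm) (length-filter (double? L) L)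

  ∑-extensions-below-max : ∀ k →
    ∑ (λ i → 𝟙 (doubleLevels (extend m π i) ≟ k)) (upTo m) ≡ ∑ (λ x → 𝟙 (suc d ∸ 𝟙 (double? L x) ≟ k)) L
  ∑-extensions-below-max k = begin
    ∑ (λ i → 𝟙 (doubleLevels (extend m π i) ≟ k)) (upTo m)
      ≡⟨ ∑-cong (upTo m) (λ i∈ → cong (λ t → 𝟙 (t ≟ k)) (level (∈-upTo⁻ i∈))) ⟩
    ∑ (φ ∘ indexOr m L) (upTo m)
      ≡⟨ ∑-map φ (indexOr m L) (upTo m) ⟨
    ∑ φ (map (indexOr m L) (upTo m))
      ≡⟨ cong (λ n → ∑ φ (map (indexOr m L) (upTo n))) (length-levels π-perm) ⟨
    ∑ φ (map (indexOr m L) (upTo (length L)))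
      ≡⟨ cong (∑ φ) (map-indexOr-upTo m L) ⟩
    ∑ φ L ∎
    where
    open ≡-Reasoning
    φ : ℕ → ℕ
    φ x = 𝟙 (suc d ∸ 𝟙 (double? L x) ≟ k)
    level : ∀ {i} → i < m → doubleLevels (extend m π i) ≡ suc d ∸ 𝟙 (double? L (indexOr m L i))
    level {i} i<m = sym (trans (cong (_∸ 𝟙 (double? L (indexOr m L i))) (sym (doubleLevels-extend i<m)))
                               (m+n∸n≡m (doubleLevels (extend m π i)) (𝟙 (double? L (indexOr m L i)))))

  length-filter-undoubledLevels : length (filter (¬? ∘ double? L) L) ≡ m ∸ 2 * d
  length-filter-undoubledLevels = begin
    length (filter (¬? ∘ double? L) L)
      ≡⟨ m+n∸m≡n (length (filter (double? L) L)) _ ⟨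
    length (filter (double? L) L) + length (filter (¬? ∘ double? L) L) ∸ length (filter (double? L) L)
      ≡⟨ cong₂ _∸_ (trans (length-filter+length-filter-¬ (double? L) L) (length-levels π-perm))
                   length-filter-doubledLevels ⟩
    m ∸ 2 * d ∎
    where open ≡-Reasoning

  count-extensions : ∀ k → length (filter (λ σ → doubleLevels σ ≟ k) (map (extend m π) (upTo (suc m))))
                         ≡ (2 * k + 1) * 𝟙 (d ≟ k) + (m ∸ 2 * d) * 𝟙 (suc d ≟ k)
  count-extensions k = begin
    length (filter (λ σ → doubleLevels σ ≟ k) (map (extend m π) (upTo (suc m))))
      ≡⟨ length-filter≡∑𝟙 (λ σ → doubleLevels σ ≟ k) (map (extend m π) (upTo (suc m))) ⟩
    ∑ (λ σ → 𝟙 (doubleLevels σ ≟ k)) (map (extend m π) (upTo (suc m)))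
      ≡⟨ ∑-map (λ σ → 𝟙 (doubleLevels σ ≟ k)) (extend m π) (upTo (suc m)) ⟩
    ∑ E (upTo (suc m))
      ≡⟨ cong (∑ E) (upTo-∷ʳ m) ⟨
    ∑ E (upTo m ∷ʳ m)
      ≡⟨ ∑-++ E (upTo m) [ m ] ⟩
    ∑ E (upTo m) + (E m + 0)
      ≡⟨ cong₂ _+_ (∑-extensions-below-max k)
                   (trans (+-identityʳ (E m)) (cong (λ t → 𝟙 (t ≟ k)) doubleLevels-extend-max)) ⟩
    ∑ (φ ∘ 𝟙 ∘ double? L) L + 𝟙 (d ≟ k)
      ≡⟨ cong (_+ 𝟙 (d ≟ k)) (∑-∘𝟙 (double? L) φ L) ⟩
    length (filter (double? L) L) * 𝟙 (d ≟ k) + length (filter (¬? ∘ double? L) L) * 𝟙 (suc d ≟ k) + 𝟙 (d ≟ k)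
      ≡⟨ cong₂ (λ a b → a * 𝟙 (d ≟ k) + b * 𝟙 (suc d ≟ k) + 𝟙 (d ≟ k))
               length-filter-doubledLevels length-filter-undoubledLevels ⟩
    2 * d * 𝟙 (d ≟ k) + (m ∸ 2 * d) * 𝟙 (suc d ≟ k) + 𝟙 (d ≟ k)
      ≡⟨ 2d𝟙[d≡k]+x+𝟙[d≡k] d k ((m ∸ 2 * d) * 𝟙 (suc d ≟ k)) ⟩
    (2 * k + 1) * 𝟙 (d ≟ k) + (m ∸ 2 * d) * 𝟙 (suc d ≟ k) ∎
    where
    open ≡-Reasoning
    E : ℕ → ℕ
    E i = 𝟙 (doubleLevels (extend m π i) ≟ k)
    φ : ℕ → ℕ
    φ b = 𝟙 (suc d ∸ b ≟ k)

R≡∑ : ∀ n k → R n k ≡ ∑ (λ π → 𝟙 (doubleLevels π ≟ k)) (Sn n)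
R≡∑ n k = length-filter≡∑𝟙 (λ π → doubleLevels π ≟ k) (Sn n)

R-suc : ∀ m k → R (suc m) k ≡
  (2 * k + 1) * R m k + ∑ (λ π → (m ∸ 2 * doubleLevels π) * 𝟙 (suc (doubleLevels π) ≟ k)) (Sn m)
R-suc m k = begin
  R (suc m) k
    ≡⟨ ↭-length (filter-↭ (λ σ → doubleLevels σ ≟ k) (Sn-suc↭extensions m)) ⟩
  length (filter (λ σ → doubleLevels σ ≟ k) (extensions m))
    ≡⟨ length-filter-cartesianProductWith (extend m) (λ σ → doubleLevels σ ≟ k) (Sn m) (upTo (suc m)) ⟩
  ∑ (λ π → length (filter (λ σ → doubleLevels σ ≟ k) (map (extend m π) (upTo (suc m))))) (Sn m)
    ≡⟨ ∑-cong (Sn m) (λ π∈ → count-extensions (∈-Sn⁻ π∈) k) ⟩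
  ∑ (λ π → (2 * k + 1) * 𝟙 (doubleLevels π ≟ k) + rest π) (Sn m)
    ≡⟨ ∑-+ (λ π → (2 * k + 1) * 𝟙 (doubleLevels π ≟ k)) rest (Sn m) ⟩
  ∑ (λ π → (2 * k + 1) * 𝟙 (doubleLevels π ≟ k)) (Sn m) + ∑ rest (Sn m)
    ≡⟨ cong (_+ ∑ rest (Sn m)) (trans (∑-*ˡ (2 * k + 1) (λ π → 𝟙 (doubleLevels π ≟ k)) (Sn m))
                                      (cong ((2 * k + 1) *_) (sym (R≡∑ m k)))) ⟩
  (2 * k + 1) * R m k + ∑ rest (Sn m) ∎
  where
  open ≡-Reasoning
  rest : List ℕ → ℕ
  rest π = (m ∸ 2 * doubleLevels π) * 𝟙 (suc (doubleLevels π) ≟ k)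

R-suc-zero : ∀ m → R (suc m) 0 ≡ R m 0
R-suc-zero m = trans (R-suc m 0)
  (trans (cong₂ _+_ (*-identityˡ (R m 0)) (∑-zero _ (Sn m) (λ {π} _ → *-zeroʳ (m ∸ 2 * doubleLevels π))))
         (+-identityʳ (R m 0)))

R-suc-suc : ∀ m k → R (suc m) (suc k) ≡ (2 * suc k + 1) * R m (suc k) + (m ∸ 2 * k) * R m k
R-suc-suc m k = trans (R-suc m (suc k)) (cong ((2 * suc k + 1) * R m (suc k) +_) (begin
  ∑ (λ π → (m ∸ 2 * doubleLevels π) * 𝟙 (suc (doubleLevels π) ≟ suc k)) (Sn m)
    ≡⟨ ∑-cong (Sn m) (λ {π} _ → shift (doubleLevels π)) ⟩
  ∑ (λ π → (m ∸ 2 * k) * 𝟙 (doubleLevels π ≟ k)) (Sn m)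
    ≡⟨ ∑-*ˡ (m ∸ 2 * k) _ (Sn m) ⟩
  (m ∸ 2 * k) * ∑ (λ π → 𝟙 (doubleLevels π ≟ k)) (Sn m)
    ≡⟨ cong ((m ∸ 2 * k) *_) (R≡∑ m k) ⟨
  (m ∸ 2 * k) * R m k ∎))
  where
  open ≡-Reasoning
  shift : ∀ d → (m ∸ 2 * d) * 𝟙 (suc d ≟ suc k) ≡ (m ∸ 2 * k) * 𝟙 (d ≟ k)
  shift d with d ≟ k
  ... | yes refl = cong ((m ∸ 2 * d) *_) (𝟙-yes (suc d ≟ suc d) refl)
  ... | no  d≢k  = trans (cong ((m ∸ 2 * d) *_) (𝟙-no (suc d ≟ suc k) (d≢k ∘ suc-injective)))
                         (trans (*-zeroʳ (m ∸ 2 * d)) (sym (*-zeroʳ (m ∸ 2 * k))))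

R-no-doubles : ∀ n → R n 0 ≡ 1
R-no-doubles zero    = refl
R-no-doubles (suc m) = trans (R-suc-zero m) (R-no-doubles m)

R-empty : ∀ k → 1 ≤ k → R 0 k ≡ 0
R-empty (suc k) _ = refl

R-vanishes : ∀ m k → ¬ 2 * k ≤ m → R m k ≡ 0
R-vanishes m k 2k≰m = cong length (filter-none (λ π → doubleLevels π ≟ k)
  (All.tabulate (λ π∈ dπ≡k → 2k≰m (subst (λ d → 2 * d ≤ m) dπ≡k (doubleLevels-bound (∈-Sn⁻ π∈))))))

open import Data.Integer using (+_)

[1+m]-2[1+k]+1≡m∸2k : ∀ m k → 2 * k ≤ m → + suc m ℤ.- + (2 * suc k) ℤ.+ + 1 ≡ + (m ∸ 2 * k)
[1+m]-2[1+k]+1≡m∸2k m k 2k≤m = begin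
  + suc m ℤ.- + (2 * suc k) ℤ.+ + 1
    ≡⟨ cong (λ n → + suc n ℤ.- + (2 * suc k) ℤ.+ + 1) (m+[n∸m]≡n 2k≤m) ⟨
  + suc (2 * k + D) ℤ.- + (2 * suc k) ℤ.+ + 1
    ≡⟨ cong₂ (λ a b → a ℤ.- b ℤ.+ + 1)
             (trans (ℤ.pos-+ 1 (2 * k + D)) (cong (ℤ._+_ (+ 1)) (ℤ.pos-+ (2 * k) D)))
             (trans (cong +_ (*-suc 2 k)) (ℤ.pos-+ 2 (2 * k))) ⟩
  + 1 ℤ.+ (+ (2 * k) ℤ.+ + D) ℤ.- (+ 2 ℤ.+ + (2 * k)) ℤ.+ + 1
    ≡⟨ solve 2 (λ K D′ → con (+ 1) :+ (K :+ D′) :- (con (+ 2) :+ K) :+ con (+ 1) := D′) refl (+ (2 * k)) (+ D) ⟩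
  + D ∎
  where
  open ≡-Reasoning
  open +-*-Solver
  D = m ∸ 2 * k

-- m ∸ 2k is truncated; when 2k > m the factor R m k vanishes instead (R-vanishes).
+[m∸2k]*r : ∀ m k r → 2 * k ≤ m ⊎ r ≡ 0 → + ((m ∸ 2 * k) * r) ≡ (+ suc m ℤ.- + (2 * suc k) ℤ.+ + 1) ℤ.* + r
+[m∸2k]*r m k r (inj₁ 2k≤m) =
  trans (ℤ.pos-* (m ∸ 2 * k) r) (cong (ℤ._* + r) (sym ([1+m]-2[1+k]+1≡m∸2k m k 2k≤m)))
+[m∸2k]*r m k .0 (inj₂ refl) =
  trans (cong +_ (*-zeroʳ (m ∸ 2 * k))) (sym (ℤ.*-zeroʳ (+ suc m ℤ.- + (2 * suc k) ℤ.+ + 1)))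

theorem3p1 : ((n k : ℕ) → 1 ≤ n → 1 ≤ k →
               + R n k ≡ + (2 * k + 1) ℤ.* + R (n ∸ 1) k
                         ℤ.+ ((+ n ℤ.- + (2 * k)) ℤ.+ + 1) ℤ.* + R (n ∸ 1) (k ∸ 1))
             × ((n : ℕ) → R n 0 ≡ 1)
             × ((k : ℕ) → 1 ≤ k → R 0 k ≡ 0)
theorem3p1 = recurrence , R-no-doubles , R-empty
  where
  recurrence : (n k : ℕ) → 1 ≤ n → 1 ≤ k →
    + R n k ≡ + (2 * k + 1) ℤ.* + R (n ∸ 1) k ℤ.+ ((+ n ℤ.- + (2 * k)) ℤ.+ + 1) ℤ.* + R (n ∸ 1) (k ∸ 1)
  recurrence (suc m) (suc k) _ _ = begin
    + R (suc m) (suc k)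
      ≡⟨ cong +_ (R-suc-suc m k) ⟩
    + ((2 * suc k + 1) * R m (suc k) + (m ∸ 2 * k) * R m k)
      ≡⟨ ℤ.pos-+ ((2 * suc k + 1) * R m (suc k)) ((m ∸ 2 * k) * R m k) ⟩
    + ((2 * suc k + 1) * R m (suc k)) ℤ.+ + ((m ∸ 2 * k) * R m k)
      ≡⟨ cong₂ ℤ._+_ (ℤ.pos-* (2 * suc k + 1) (R m (suc k))) (+[m∸2k]*r m k (R m k) support) ⟩
    + (2 * suc k + 1) ℤ.* + R m (suc k) ℤ.+ (+ suc m ℤ.- + (2 * suc k) ℤ.+ + 1) ℤ.* + R m k ∎
    where
    open ≡-Reasoning
    support : 2 * k ≤ m ⊎ R m k ≡ 0
    support with 2 * k ≤? m
    ... | yes 2k≤m = inj₁ 2k≤m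
    ... | no  2k≰m = inj₂ (R-vanishes m k 2k≰m)
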